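{- Let $\mathcal{Q}$ be a finite forest poset and let $\mathcal{H}_\mathcal{Q}(t)=\sum_{n\ge1}\dim\mathsf{As}(\mathcal{Q})(n)\,t^n$ be the Hilbert series of $\mathsf{As}(\mathcal{Q})$. Then there are formal power series $\mathcal{H}^a_\mathcal{Q}(t)$, $a\in\mathcal{Q}$, without constant term, such that $$\mathcal{H}_\mathcal{Q}(t)=t+\sum_{a\in\mathcal{Q}}\mathcal{H}^a_\mathcal{Q}(t),\qquad \mathcal{H}^a_\mathcal{Q}(t)=\big(t+\bar{\mathcal{H}}^a_\mathcal{Q}(t)\big)\big(t+\bar{\mathcal{H}}^a_\mathcal{Q}(t)+\mathcal{H}^a_\mathcal{Q}(t)\big)\ (a\in\mathcal{Q}),$$ where $\bar{\mathcal{H}}^a_\mathcal{Q}(t):=\sum_{b}\mathcal{H}^b_\mathcal{Q}(t)$, the sum ranging over all $b\in\mathcal{Q}$ incomparable with $a$.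
   Context: Operads are nonsymmetric over a field of characteristic zero. For comparable $a,b$, $a\uparrow_\mathcal{Q} b:=\min(a,b)$. $\mathsf{As}(\mathcal{Q})$ is the operad generated by binary generators $\star_a$, $a\in\mathcal{Q}$, subject to $\star_a\circ_1\star_b=\star_{a\uparrow b}\circ_2\star_{a\uparrow b}$ and $\star_{a\uparrow b}\circ_1\star_{a\uparrow b}=\star_a\circ_2\star_b$ for all comparable $a,b$ (including $a=b$); $\mathsf{As}(\mathcal{Q})(n)$ is its arity-$n$ component. A forest poset is a poset with no element lying strictly above two incomparable elements. -}

module Defs where

open import Data.Nat as ℕ using (ℕ; zero; suc)
open import Data.Fin using (Fin; zero; suc)
open import Data.Integer using (+_)
open import Data.Rational using (ℚ; 0ℚ; 1ℚ; _/_) renaming (_+_ to _+ℚ_; _*_ to _*ℚ_)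
open import Data.Product using (Σ; _×_; _,_; ∃)
open import Data.Sum using (_⊎_)
open import Relation.Nullary using (¬_; Dec; yes; no)
open import Relation.Binary.PropositionalEquality using (_≡_; _≢_)
open import Relation.Binary.Structures using (IsDecPartialOrder)

record FinPoset : Set₁ where
  field
    size  : ℕ
    _≤_   : Fin size → Fin size → Set
    isDecPartialOrder : IsDecPartialOrder _≡_ _≤_

  Elt : Set
  Elt = Fin size

  _<_ : Elt → Elt → Set
  a < b = (a ≤ b) × (a ≢ b)

  Comparable : Elt → Elt → Set
  Comparable a b = (a ≤ b) ⊎ (b ≤ a)

  open IsDecPartialOrder isDecPartialOrder public using (_≤?_)

  incomparable? : (a b : Elt) → Dec (¬ Comparable a b)
  incomparable? a b with a ≤? b | b ≤? a
  ... | yes p | _     = no (λ f → f (Data.Sum.inj₁ p))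
  ... | no _  | yes q = no (λ f → f (Data.Sum.inj₂ q))
  ... | no p  | no q  = yes λ { (Data.Sum.inj₁ x) → p x ; (Data.Sum.inj₂ y) → q y }

open FinPoset public using (Elt)

IsForest : FinPoset → Set
IsForest Q = ∀ x y z → y < x → z < x → Comparable y z
  where open FinPoset Q

-- Trees: binary trees with internal nodes labelled by elements of Q
-- (= basis of the free nonsymmetric operad on the generators ⋆_a).

data Tree (Q : FinPoset) : Set where
  leaf : Tree Q
  node : Elt Q → Tree Q → Tree Q → Tree Q   -- node a l r = ⋆_a ∘ (l , r)

arity : ∀ {Q} → Tree Q → ℕ
arity leaf = 1
arity (node _ l r) = arity l ℕ.+ arity r

-- m = a ↑ b = min(a,b) for comparable a, b.
IsMin : (Q : FinPoset) → Elt Q → Elt Q → Elt Q → Set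
IsMin Q a b m = ((a ≤ b) × (m ≡ a)) ⊎ ((b ≤ a) × (m ≡ b))
  where open FinPoset Q

-- Operadic congruence generated by the relations
--   ⋆_a ∘₁ ⋆_b = ⋆_{a↑b} ∘₂ ⋆_{a↑b}   and   ⋆_{a↑b} ∘₁ ⋆_{a↑b} = ⋆_a ∘₂ ⋆_b
-- (substitution of arbitrary trees x,y,z into the inputs and closure
--  under contexts, symmetry and transitivity).
data _~_ {Q : FinPoset} : Tree Q → Tree Q → Set where
  rel₁ : ∀ a b m x y z → IsMin Q a b m →
         node a (node b x y) z ~ node m x (node m y z)
  rel₂ : ∀ a b m x y z → IsMin Q a b m →
         node m (node m x y) z ~ node a x (node b y z)
  ~-refl  : ∀ {t} → t ~ t
  ~-sym   : ∀ {s t} → s ~ t → t ~ s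
  ~-trans : ∀ {s t u} → s ~ t → t ~ u → s ~ u
  ~-node  : ∀ a {l l' r r'} → l ~ l' → r ~ r' → node a l r ~ node a l' r'

-- Since all relations are binomials
-- (tree = tree), As(Q)(n) has as basis the ~-classes of trees of arity n;
-- d is the number of such classes (a complete list of pairwise
-- inequivalent representatives of length d).
DimAs : (Q : FinPoset) → ℕ → ℕ → Set
DimAs Q n d =
  Σ (Fin d → Tree Q) λ rep →
    (∀ i → arity (rep i) ≡ n) ×
    (∀ i j → rep i ~ rep j → i ≡ j) ×
    (∀ t → arity t ≡ n → ∃ λ i → t ~ rep i)

Series : Set
Series = ℕ → ℚ

fromℕℚ : ℕ → ℚ
fromℕℚ n = + n / 1

sumFin : ∀ {k} → (Fin k → ℚ) → ℚ
sumFin {zero} f = 0ℚ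
sumFin {suc k} f = f zero +ℚ sumFin (λ i → f (suc i))

tSeries : Series
tSeries (suc zero) = 1ℚ
tSeries _ = 0ℚ

_⊕_ : Series → Series → Series
(f ⊕ g) n = f n +ℚ g n

convSum : Series → Series → ℕ → ℚ
convSum f g zero = f zero *ℚ g zero
convSum f g (suc n) = (f zero *ℚ g (suc n)) +ℚ convSum (λ i → f (suc i)) g n

_⊗_ : Series → Series → Series
(f ⊗ g) n = convSum f g n

sumSeries : (Q : FinPoset) → (Elt Q → Series) → Series
sumSeries Q H n = sumFin (λ a → H a n)

barSeries : (Q : FinPoset) → (Elt Q → Series) → Elt Q → Series
barSeries Q H a n = sumFin (λ b → pick (FinPoset.incomparable? Q a b) (H b n))
  where
    pick : ∀ {P : Set} → Dec P → ℚ → ℚ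
    pick (yes _) q = q
    pick (no _)  _ = 0ℚ

hilbert : (ℕ → ℕ) → Series
hilbert d zero = 0ℚ
hilbert d (suc n) = fromℕℚ (d (suc n))

{-# OPTIONS --safe #-}
module Submission where

open import Defs
open import Data.Nat using (ℕ; suc)
open import Data.Rational using (0ℚ)
open import Data.Product using (Σ; _×_)
open import Relation.Binary.PropositionalEquality using (_≡_)

open import Data.Bool using (if_then_else_)
open import Data.Empty using (⊥; ⊥-elim)
open import Data.Fin as Fin using (Fin; zero; suc)
import Data.Fin.Properties as Finₚ
open import Data.Integer as ℤ using (+_)
import Data.Integer.Properties as ℤₚ
open import Data.List as List using (List; []; _∷_; _++_; length; concat; tabulate; lookup; cartesianProductWith)
import Data.List.Properties as Listₚ
open import Data.List.Membership.Propositional using (_∈_)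
open import Data.List.Membership.Propositional.Properties
  using (∈-++⁺ˡ; ∈-++⁺ʳ; ∈-++⁻; ∈-lookup; ∈-tabulate⁺; ∈-tabulate⁻; ∈-cartesianProductWith⁺; ∈-cartesianProductWith⁻)
open import Data.List.Relation.Binary.Subset.Propositional using (_⊆_)
open import Data.List.Relation.Unary.All as All using (All; []; _∷_)
import Data.List.Relation.Unary.All.Properties as Allₚ
open import Data.List.Relation.Unary.AllPairs using ([]; _∷_)
open import Data.List.Relation.Unary.Any using (here; index)
open import Data.List.Relation.Unary.Any.Properties using (lookup-index)
open import Data.List.Relation.Unary.Unique.Propositional using (Unique)
import Data.List.Relation.Unary.Unique.Propositional.Properties as Uniqueₚ
open import Data.Maybe using (Maybe; just; nothing)
import Data.Maybe.Properties as Maybeₚ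
open import Data.Nat as ℕ using (zero; _∸_; z≤n; s≤s)
import Data.Nat.Properties as ℕₚ
open import Data.Product using (_,_; proj₁; proj₂; ∃)
import Data.Product
import Data.Rational as ℚ
open import Data.Rational using (ℚ; toℚᵘ)
import Data.Rational.Properties as ℚₚ
import Data.Rational.Unnormalised as ℚᵘ
import Data.Rational.Unnormalised.Properties as ℚᵘₚ
open import Data.Sum using (_⊎_; inj₁; inj₂)
import Data.Sum
open import Data.Unit using (⊤; tt)
open import Function using (id; _∘_; _∘₂_)
open import Level using (0ℓ)
open import Relation.Binary.Bundles using (Setoid)
open import Relation.Binary.PropositionalEquality
  using (refl; sym; trans; cong; cong₂; subst; _≢_; module ≡-Reasoning)
import Relation.Binary.Reasoning.Setoid as SetoidReasoning
open import Relation.Binary.Structures using (IsDecPartialOrder)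
open import Relation.Nullary using (¬_; Dec; yes; no; does)
open import Relation.Unary using (Pred; _∪_; _≐_)

-- Besides the leaf, normal forms are right combs ⋆_a(t₁, ⋆_a(t₂, …, ⋆_a(t_{m-1}, t_m))), m ≥ 2,
-- whose factors tᵢ are leaves or normal forms with root incomparable to a. Cutting such a comb after its first factor
-- gives H^a = (t + H̄^a)(t + H̄^a + H^a), and t + Σ_a H^a counts all normal forms.
-- They form a basis of As(Q) because, on a forest poset, they carry an operation ⋆_k satisfying
-- both relations: its root label is the least of k and those roots of the arguments that lie
-- below k (below k a forest is a chain), and the factors of the arguments comparable to that
-- label are merged into one comb. Evaluating trees with this operation is therefore constant on
-- ~-classes, every tree is ~ to its value, and normal forms evaluate to themselves.

ℕ→ℚᵘ : ℕ → ℚᵘ.ℚᵘ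
ℕ→ℚᵘ n = ℚᵘ.mkℚᵘ (+ n) 0

toℚᵘ-fromℕℚ : ∀ n → toℚᵘ (fromℕℚ n) ℚᵘ.≃ ℕ→ℚᵘ n
toℚᵘ-fromℕℚ n = ℚₚ.toℚᵘ-fromℚᵘ (ℕ→ℚᵘ n)

ℕ→ℚᵘ-+ : ∀ m n → ℕ→ℚᵘ (m ℕ.+ n) ℚᵘ.≃ ℕ→ℚᵘ m ℚᵘ.+ ℕ→ℚᵘ n
ℕ→ℚᵘ-+ m n = ℚᵘ.*≡* (begin
  + (m ℕ.+ n) ℤ.* ℤ.1ℤ                ≡⟨ ℤₚ.*-identityʳ _ ⟩
  + (m ℕ.+ n)                          ≡⟨ ℤₚ.pos-+ m n ⟩
  + m ℤ.+ + n                          ≡⟨ cong₂ ℤ._+_ (ℤₚ.*-identityʳ (+ m)) (ℤₚ.*-identityʳ (+ n)) ⟨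
  + m ℤ.* ℤ.1ℤ ℤ.+ + n ℤ.* ℤ.1ℤ        ≡⟨ ℤₚ.*-identityʳ _ ⟨
  (+ m ℤ.* ℤ.1ℤ ℤ.+ + n ℤ.* ℤ.1ℤ) ℤ.* ℤ.1ℤ ∎)
  where open ≡-Reasoning

ℕ→ℚᵘ-* : ∀ m n → ℕ→ℚᵘ (m ℕ.* n) ℚᵘ.≃ ℕ→ℚᵘ m ℚᵘ.* ℕ→ℚᵘ n
ℕ→ℚᵘ-* m n = ℚᵘ.*≡* (begin
  + (m ℕ.* n) ℤ.* ℤ.1ℤ    ≡⟨ ℤₚ.*-identityʳ _ ⟩
  + (m ℕ.* n)              ≡⟨ ℤₚ.pos-* m n ⟩
  + m ℤ.* + n              ≡⟨ ℤₚ.*-identityʳ _ ⟨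
  (+ m ℤ.* + n) ℤ.* ℤ.1ℤ   ∎)
  where open ≡-Reasoning

fromℕℚ-+ : ∀ m n → fromℕℚ (m ℕ.+ n) ≡ fromℕℚ m ℚ.+ fromℕℚ n
fromℕℚ-+ m n = ℚₚ.toℚᵘ-injective (begin
  toℚᵘ (fromℕℚ (m ℕ.+ n))                ≈⟨ toℚᵘ-fromℕℚ (m ℕ.+ n) ⟩
  ℕ→ℚᵘ (m ℕ.+ n)                         ≈⟨ ℕ→ℚᵘ-+ m n ⟩
  ℕ→ℚᵘ m ℚᵘ.+ ℕ→ℚᵘ n                     ≈⟨ ℚᵘₚ.+-cong (toℚᵘ-fromℕℚ m) (toℚᵘ-fromℕℚ n) ⟨
  toℚᵘ (fromℕℚ m) ℚᵘ.+ toℚᵘ (fromℕℚ n)   ≈⟨ ℚₚ.toℚᵘ-homo-+ (fromℕℚ m) (fromℕℚ n) ⟨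
  toℚᵘ (fromℕℚ m ℚ.+ fromℕℚ n)           ∎)
  where open ℚᵘₚ.≃-Reasoning

fromℕℚ-* : ∀ m n → fromℕℚ (m ℕ.* n) ≡ fromℕℚ m ℚ.* fromℕℚ n
fromℕℚ-* m n = ℚₚ.toℚᵘ-injective (begin
  toℚᵘ (fromℕℚ (m ℕ.* n))                ≈⟨ toℚᵘ-fromℕℚ (m ℕ.* n) ⟩
  ℕ→ℚᵘ (m ℕ.* n)                         ≈⟨ ℕ→ℚᵘ-* m n ⟩
  ℕ→ℚᵘ m ℚᵘ.* ℕ→ℚᵘ n                     ≈⟨ ℚᵘₚ.*-cong (toℚᵘ-fromℕℚ m) (toℚᵘ-fromℕℚ n) ⟨
  toℚᵘ (fromℕℚ m) ℚᵘ.* toℚᵘ (fromℕℚ n)   ≈⟨ ℚₚ.toℚᵘ-homo-* (fromℕℚ m) (fromℕℚ n) ⟨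
  toℚᵘ (fromℕℚ m ℚ.* fromℕℚ n)           ∎)
  where open ℚᵘₚ.≃-Reasoning

sumFin-cong : ∀ {k} {f g : Fin k → ℚ} → (∀ i → f i ≡ g i) → sumFin f ≡ sumFin g
sumFin-cong {zero}  f≗g = refl
sumFin-cong {suc k} f≗g = cong₂ ℚ._+_ (f≗g zero) (sumFin-cong (f≗g ∘ suc))

private
  Selector : Set₁
  Selector = ∀ {P : Set} → Dec P → ℚ → ℚ

  -- barSeries filters its summands through a helper local to Defs, which cannot be named.
  -- With the arguments of the first summand (and ℚ._+_, which would otherwise unfold)
  -- abstracted to variables, unification solves for it.
  barSeries-selector : ∀ Q H a n → Σ Selector λ pick →
    (∀ {P : Set} (d : Dec P) q → pick d q ≡ (if does d then q else 0ℚ)) ×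
    barSeries Q H a n ≡ sumFin (λ b → pick (FinPoset.incomparable? Q a b) (H b n))
  barSeries-selector Q@record { size = suc _ } H a n
    with ¬ FinPoset.Comparable Q a zero | FinPoset.incomparable? Q a zero | H zero n | ℚ._+_
  ... | _ | _ | _ | _ = _ , (λ { (yes _) _ → refl ; (no _) _ → refl }) , refl

barSeries-select : ∀ Q H a n →
  barSeries Q H a n ≡ sumFin (λ b → if does (FinPoset.incomparable? Q a b) then H b n else 0ℚ)
barSeries-select Q H a n with barSeries-selector Q H a n
... | _ , selects , bar≡ = trans bar≡ (sumFin-cong (λ b → selects (FinPoset.incomparable? Q a b) (H b n)))

convSum-cong : ∀ {f g f′ g′ : Series} n → (∀ i → i ℕ.≤ n → f i ℚ.* g (n ∸ i) ≡ f′ i ℚ.* g′ (n ∸ i)) →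
               convSum f g n ≡ convSum f′ g′ n
convSum-cong zero    eq = eq 0 z≤n
convSum-cong (suc n) eq = cong₂ ℚ._+_ (eq 0 z≤n) (convSum-cong n (λ i i≤n → eq (suc i) (s≤s i≤n)))

count : ∀ {A : Set} → List A → ℚ
count xs = fromℕℚ (length xs)

module _ {A : Set} where

  record Enumerates (P : A → Set) (xs : List A) : Set where
    field
      unique   : Unique xs
      sound    : ∀ {x} → x ∈ xs → P x
      complete : ∀ {x} → P x → x ∈ xs

  Unique⇒lookup-injective : ∀ {xs : List A} → Unique xs → ∀ {i j} → lookup xs i ≡ lookup xs j → i ≡ j
  Unique⇒lookup-injective {_ ∷ _} _         {zero}  {zero}  _  = refl
  Unique⇒lookup-injective {_ ∷ _} (x∉ ∷ _)  {zero}  {suc j} eq = ⊥-elim (All.lookup x∉ (∈-lookup j) eq)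
  Unique⇒lookup-injective {_ ∷ _} (x∉ ∷ _)  {suc i} {zero}  eq = ⊥-elim (All.lookup x∉ (∈-lookup i) (sym eq))
  Unique⇒lookup-injective {_ ∷ _} (_ ∷ uxs) {suc i} {suc j} eq = cong suc (Unique⇒lookup-injective uxs eq)

  Unique-⊆⇒length-≤ : ∀ {xs ys : List A} → Unique xs → xs ⊆ ys → length xs ℕ.≤ length ys
  Unique-⊆⇒length-≤ {xs} {ys} uxs xs⊆ys = Finₚ.injective⇒≤ position-injective
    where
      position : Fin (length xs) → Fin (length ys)
      position i = index (xs⊆ys (∈-lookup i))

      position-injective : ∀ {i j} → position i ≡ position j → i ≡ j
      position-injective {i} {j} eq = Unique⇒lookup-injective uxs (begin
        lookup xs i             ≡⟨ lookup-index (xs⊆ys (∈-lookup i)) ⟩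
        lookup ys (position i)  ≡⟨ cong (lookup ys) eq ⟩
        lookup ys (position j)  ≡⟨ lookup-index (xs⊆ys (∈-lookup j)) ⟨
        lookup xs j             ∎)
        where open ≡-Reasoning

  enumerations-length : ∀ {P : A → Set} {xs ys} → Enumerates P xs → Enumerates P ys → length xs ≡ length ys
  enumerations-length exs eys = ℕₚ.≤-antisym
    (Unique-⊆⇒length-≤ (unique exs) (complete eys ∘ sound exs))
    (Unique-⊆⇒length-≤ (unique eys) (complete exs ∘ sound eys))
    where open Enumerates

  enumeration-of-∅ : ∀ {P : A → Set} {xs} → (∀ {x} → ¬ P x) → Enumerates P xs → xs ≡ []
  enumeration-of-∅ {xs = []}    _  _    = refl
  enumeration-of-∅ {xs = x ∷ _} ¬P exs = ⊥-elim (¬P (Enumerates.sound exs (here refl)))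

  ∈-concat-tabulate⁺ : ∀ {k} (f : Fin k → List A) i {x} → x ∈ f i → x ∈ concat (tabulate f)
  ∈-concat-tabulate⁺ f zero    x∈ = ∈-++⁺ˡ x∈
  ∈-concat-tabulate⁺ f (suc i) x∈ = ∈-++⁺ʳ (f zero) (∈-concat-tabulate⁺ (f ∘ suc) i x∈)

  ∈-concat-tabulate⁻ : ∀ {k} (f : Fin k → List A) {x} → x ∈ concat (tabulate f) → ∃ λ i → x ∈ f i
  ∈-concat-tabulate⁻ {suc k} f x∈ with ∈-++⁻ (f zero) x∈
  ... | inj₁ x∈f₀ = zero , x∈f₀
  ... | inj₂ x∈fs = let i , x∈fᵢ = ∈-concat-tabulate⁻ (f ∘ suc) x∈fs in suc i , x∈fᵢ

  concat-tabulate-unique : ∀ {k} (f : Fin k → List A) → (∀ i → Unique (f i)) →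
    (∀ {i j x} → x ∈ f i → x ∈ f j → i ≡ j) → Unique (concat (tabulate f))
  concat-tabulate-unique {zero}  f _   _        = []
  concat-tabulate-unique {suc k} f ufs disjoint =
    Uniqueₚ.++⁺ (ufs zero) (concat-tabulate-unique (f ∘ suc) (ufs ∘ suc) (Finₚ.suc-injective ∘₂ disjoint))
      (λ (x∈f₀ , x∈fs) → let i , x∈fᵢ = ∈-concat-tabulate⁻ (f ∘ suc) x∈fs in Finₚ.0≢1+n (disjoint x∈f₀ x∈fᵢ))

  if-unique : ∀ {P : Set} (d : Dec P) {xs : List A} → Unique xs → Unique (if does d then xs else [])
  if-unique (yes _) uxs = uxs
  if-unique (no _)  _   = []

  ∈-if⁺ : ∀ {P : Set} (d : Dec P) {xs : List A} {x} → P → x ∈ xs → x ∈ (if does d then xs else [])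
  ∈-if⁺ (yes _) _ x∈ = x∈
  ∈-if⁺ (no ¬p) p _  = ⊥-elim (¬p p)

  ∈-if⁻ : ∀ {P : Set} (d : Dec P) {xs : List A} {x} → x ∈ (if does d then xs else []) → P × x ∈ xs
  ∈-if⁻ (yes p) x∈ = p , x∈

  count-++ : ∀ (xs ys : List A) → count (xs ++ ys) ≡ count xs ℚ.+ count ys
  count-++ xs ys = trans (cong fromℕℚ (Listₚ.length-++ xs)) (fromℕℚ-+ (length xs) (length ys))

  count-cartesianProductWith : ∀ {B C : Set} (f : A → B → C) xs ys →
    count (cartesianProductWith f xs ys) ≡ count xs ℚ.* count ys
  count-cartesianProductWith f xs ys =
    trans (cong fromℕℚ (length-cartesianProductWith xs)) (fromℕℚ-* (length xs) (length ys))
    where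
      length-cartesianProductWith : ∀ xs → length (cartesianProductWith f xs ys) ≡ length xs ℕ.* length ys
      length-cartesianProductWith []       = refl
      length-cartesianProductWith (x ∷ xs) = begin
        length (List.map (f x) ys ++ cartesianProductWith f xs ys)           ≡⟨ Listₚ.length-++ (List.map (f x) ys) ⟩
        length (List.map (f x) ys) ℕ.+ length (cartesianProductWith f xs ys) ≡⟨ cong₂ ℕ._+_ (Listₚ.length-map (f x) ys)
                                                                                  (length-cartesianProductWith xs) ⟩
        length ys ℕ.+ length xs ℕ.* length ys                                ∎
        where open ≡-Reasoning

  count-if : ∀ {P : Set} (d : Dec P) (xs : List A) →
    count (if does d then xs else []) ≡ (if does d then count xs else 0ℚ)
  count-if (yes _) _ = refl
  count-if (no _)  _ = refl

  count-concat-tabulate : ∀ {k} (f : Fin k → List A) → count (concat (tabulate f)) ≡ sumFin (count ∘ f)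
  count-concat-tabulate {zero}  f = refl
  count-concat-tabulate {suc k} f = begin
    count (f zero ++ concat (tabulate (f ∘ suc)))
      ≡⟨ count-++ (f zero) (concat (tabulate (f ∘ suc))) ⟩
    count (f zero) ℚ.+ count (concat (tabulate (f ∘ suc)))
      ≡⟨ cong (count (f zero) ℚ.+_) (count-concat-tabulate (f ∘ suc)) ⟩
    count (f zero) ℚ.+ sumFin (count ∘ f ∘ suc)
      ∎
    where open ≡-Reasoning

NonEmpty : ∀ {A : Set} → List A → Set
NonEmpty []      = ⊥
NonEmpty (_ ∷ _) = ⊤

++-nonEmptyˡ : ∀ {A : Set} (xs : List A) {ys} → NonEmpty xs → NonEmpty (xs ++ ys)
++-nonEmptyˡ (_ ∷ _) _ = tt

++-nonEmptyʳ : ∀ {A : Set} (xs : List A) {ys} → NonEmpty ys → NonEmpty (xs ++ ys)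
++-nonEmptyʳ []      ne = ne
++-nonEmptyʳ (_ ∷ _) _  = tt

arity-positive : ∀ {Q} (t : Tree Q) → 1 ℕ.≤ arity t
arity-positive leaf         = s≤s z≤n
arity-positive (node _ l r) = ℕₚ.≤-trans (arity-positive l) (ℕₚ.m≤m+n (arity l) (arity r))

module PosetProperties (Q : FinPoset) where
  open FinPoset Q hiding (Elt)
  open IsDecPartialOrder isDecPartialOrder public
    using (antisym) renaming (refl to ≤-refl; trans to ≤-trans)

  comparable-refl : ∀ {a} → Comparable a a
  comparable-refl = inj₁ ≤-refl

  comparable-sym : ∀ {a b} → Comparable a b → Comparable b a
  comparable-sym = Data.Sum.swap

  comparable? : ∀ a b → Dec (Comparable a b)
  comparable? a b with a ≤? b | b ≤? a
  ... | yes a≤b | _       = yes (inj₁ a≤b)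
  ... | no _    | yes b≤a = yes (inj₂ b≤a)
  ... | no a≰b  | no b≰a  = no λ { (inj₁ a≤b) → a≰b a≤b ; (inj₂ b≤a) → b≰a b≤a }

  min-refl : ∀ {a} → IsMin Q a a a
  min-refl = inj₁ (≤-refl , refl)

  module _ (forest : IsForest Q) where

    forest-comparable : ∀ {x y z} → x ≤ z → y ≤ z → Comparable x y
    forest-comparable {x} {y} {z} x≤z y≤z with x Fin.≟ z | y Fin.≟ z
    ... | yes refl | _        = inj₂ y≤z
    ... | no _     | yes refl = inj₁ x≤z
    ... | no x≢z   | no y≢z   = forest z x y (x≤z , x≢z) (y≤z , y≢z)

    comparable-below : ∀ {L k c} → L ≤ k → Comparable k c → Comparable L c
    comparable-below L≤k (inj₁ k≤c) = inj₁ (≤-trans L≤k k≤c)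
    comparable-below L≤k (inj₂ c≤k) = forest-comparable L≤k c≤k

module NormalForms (Q : FinPoset) where
  open FinPoset Q hiding (Elt)

  root : Tree Q → Maybe (Elt Q)
  root leaf         = nothing
  root (node a _ _) = just a

  Unrelated : Elt Q → Maybe (Elt Q) → Set
  Unrelated a nothing  = ⊤
  Unrelated a (just c) = ¬ Comparable a c

  Continues : Elt Q → Maybe (Elt Q) → Set
  Continues a m = Unrelated a m ⊎ m ≡ just a

  IsNF : Tree Q → Set
  IsNF leaf         = ⊤
  IsNF (node a l r) = IsNF l × IsNF r × Unrelated a (root l) × Continues a (root r)

  NFOfArity : ℕ → Tree Q → Set
  NFOfArity n t = IsNF t × arity t ≡ n

module Counting (Q : FinPoset) where
  open FinPoset Q using (size; incomparable?)
  open PosetProperties Q using (comparable-refl)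
  open NormalForms Q

  Rooted : Elt Q → ℕ → Tree Q → Set
  Rooted a n t = IsNF t × root t ≡ just a × arity t ≡ n

  LeftFactor : Elt Q → ℕ → Tree Q → Set
  LeftFactor a n t = IsNF t × Unrelated a (root t) × arity t ≡ n

  RightFactor : Elt Q → ℕ → Tree Q → Set
  RightFactor a n t = IsNF t × Continues a (root t) × arity t ≡ n

  unit : ℕ → List (Tree Q)
  unit 1 = leaf ∷ []
  unit _ = []

  -- The trees node a l r with l ∈ F i, r ∈ G j and i + j = n, in the order of convSum.
  grafts : Elt Q → (ℕ → List (Tree Q)) → (ℕ → List (Tree Q)) → ℕ → List (Tree Q)
  grafts a F G zero    = cartesianProductWith (node a) (F 0) (G 0)
  grafts a F G (suc n) = cartesianProductWith (node a) (F 0) (G (suc n)) ++ grafts a (F ∘ suc) G n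

  -- The first argument is fuel: the lists are complete once it reaches the arity.
  mutual
    rooted : ℕ → Elt Q → ℕ → List (Tree Q)
    rooted zero    a n = []
    rooted (suc f) a n = grafts a (leftFactors f a) (rightFactors f a) n

    leftFactors : ℕ → Elt Q → ℕ → List (Tree Q)
    leftFactors f a n = unit n ++ concat (tabulate λ b → if does (incomparable? a b) then rooted f b n else [])

    rightFactors : ℕ → Elt Q → ℕ → List (Tree Q)
    rightFactors f a n = leftFactors f a n ++ rooted f a n

  normalForms : ℕ → List (Tree Q)
  normalForms n = unit n ++ concat (tabulate λ a → rooted (suc n) a n)

  ∈-unit⁻ : ∀ {n t} → t ∈ unit n → t ≡ leaf × n ≡ 1
  ∈-unit⁻ {1} (here t≡leaf) = t≡leaf , refl

  unit-unique : ∀ n → Unique (unit n)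
  unit-unique 0             = []
  unit-unique 1             = [] ∷ []
  unit-unique (suc (suc _)) = []

  record IsGraft (a : Elt Q) (F G : ℕ → List (Tree Q)) (n : ℕ) (t : Tree Q) : Set where
    constructor isGraft
    field
      {i j}  : ℕ
      {l r}  : Tree Q
      i+j≡n  : i ℕ.+ j ≡ n
      l∈F    : l ∈ F i
      r∈G    : r ∈ G j
      t≡node : t ≡ node a l r

  ∈-grafts⁻ : ∀ {a F G} n {t} → t ∈ grafts a F G n → IsGraft a F G n t
  ∈-grafts⁻ {a} {F} {G} zero t∈
    with _ , _ , l∈ , r∈ , refl ← ∈-cartesianProductWith⁻ (node a) (F 0) (G 0) t∈ = isGraft refl l∈ r∈ refl
  ∈-grafts⁻ {a} {F} {G} (suc n) t∈ with ∈-++⁻ (cartesianProductWith (node a) (F 0) (G (suc n))) t∈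
  ... | inj₁ t∈pairs
    with _ , _ , l∈ , r∈ , refl ← ∈-cartesianProductWith⁻ (node a) (F 0) (G (suc n)) t∈pairs = isGraft refl l∈ r∈ refl
  ... | inj₂ t∈rest
    with isGraft i+j≡n l∈ r∈ refl ← ∈-grafts⁻ n t∈rest = isGraft (cong suc i+j≡n) l∈ r∈ refl

  ∈-grafts⁺ : ∀ {a F G} i {j l r} → l ∈ F i → r ∈ G j → node a l r ∈ grafts a F G (i ℕ.+ j)
  ∈-grafts⁺ {a}         zero    {zero}  l∈ r∈ = ∈-cartesianProductWith⁺ (node a) l∈ r∈
  ∈-grafts⁺ {a}         zero    {suc j} l∈ r∈ = ∈-++⁺ˡ (∈-cartesianProductWith⁺ (node a) l∈ r∈)
  ∈-grafts⁺ {a} {F} {G} (suc i) {j}     l∈ r∈ =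
    ∈-++⁺ʳ (cartesianProductWith (node a) (F 0) (G (suc (i ℕ.+ j)))) (∈-grafts⁺ i l∈ r∈)

  node-injective : ∀ {a} {l l′ r r′ : Tree Q} → node a l r ≡ node a l′ r′ → l ≡ l′ × r ≡ r′
  node-injective refl = refl , refl

  grafts-unique : ∀ {a F G} n → (∀ i → Unique (F i)) → (∀ j → Unique (G j)) →
    (∀ {i i′ l} → l ∈ F i → l ∈ F i′ → i ≡ i′) → Unique (grafts a F G n)
  grafts-unique {a} zero ufs ugs _ = Uniqueₚ.cartesianProductWith⁺ (node a) node-injective (ufs 0) (ugs 0)
  grafts-unique {a} {F} {G} (suc n) ufs ugs disjoint = Uniqueₚ.++⁺
    (Uniqueₚ.cartesianProductWith⁺ (node a) node-injective (ufs 0) (ugs (suc n)))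
    (grafts-unique n (ufs ∘ suc) ugs (ℕₚ.suc-injective ∘₂ disjoint))
    λ (t∈pairs , t∈rest) → split-differs t∈pairs (∈-grafts⁻ n t∈rest)
    where
      split-differs : ∀ {t} → t ∈ cartesianProductWith (node a) (F 0) (G (suc n)) →
                      ¬ IsGraft a (F ∘ suc) G n t
      split-differs t∈ (isGraft _ l∈ _ refl)
        with _ , _ , l′∈ , _ , eq ← ∈-cartesianProductWith⁻ (node a) (F 0) (G (suc n)) t∈
        with refl , refl ← node-injective eq = ℕₚ.0≢1+n (disjoint l′∈ l∈)

  arity≢0 : ∀ (t : Tree Q) → arity t ≢ 0
  arity≢0 t eq = ℕₚ.1+n≰n (subst (1 ℕ.≤_) eq (arity-positive t))

  mutual
    rooted-sound : ∀ f {a n t} → t ∈ rooted f a n → Rooted a n t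
    rooted-sound (suc f) {n = n} t∈ with isGraft i+j≡n l∈ r∈ refl ← ∈-grafts⁻ n t∈ =
      let nf-l , unrelated , arity-l = leftFactors-sound f l∈
          nf-r , continues , arity-r = rightFactors-sound f r∈
      in (nf-l , nf-r , unrelated , continues) , refl , trans (cong₂ ℕ._+_ arity-l arity-r) i+j≡n

    leftFactors-sound : ∀ f {a n t} → t ∈ leftFactors f a n → LeftFactor a n t
    leftFactors-sound f {a} {n} t∈ with ∈-++⁻ (unit n) t∈
    ... | inj₁ t∈unit with refl , refl ← ∈-unit⁻ t∈unit = tt , tt , refl
    ... | inj₂ t∈rest =
      let b , t∈b          = ∈-concat-tabulate⁻ _ t∈rest
          unrelated , t∈ab = ∈-if⁻ (incomparable? a b) t∈b
          nf , root≡b , arity≡n = rooted-sound f t∈ab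
      in nf , subst (Unrelated a) (sym root≡b) unrelated , arity≡n

    rightFactors-sound : ∀ f {a n t} → t ∈ rightFactors f a n → RightFactor a n t
    rightFactors-sound f {a} {n} t∈ with ∈-++⁻ (leftFactors f a n) t∈
    ... | inj₁ t∈left  = let nf , unrelated , arity≡n = leftFactors-sound f t∈left in nf , inj₁ unrelated , arity≡n
    ... | inj₂ t∈right = let nf , root≡a , arity≡n = rooted-sound f t∈right in nf , inj₂ root≡a , arity≡n

  mutual
    rooted-complete : ∀ {f a n t} → Rooted a n t → n ℕ.≤ f → t ∈ rooted f a n
    rooted-complete {zero} {t = t} (_ , _ , refl) n≤0 = ⊥-elim (arity≢0 t (ℕₚ.n≤0⇒n≡0 n≤0))
    rooted-complete {suc f} {t = node a l r} ((nf-l , nf-r , unrelated , continues) , refl , refl) n≤1+f =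
      ∈-grafts⁺ (arity l) (leftFactors-complete (nf-l , unrelated , refl) l≤f)
                          (rightFactors-complete (nf-r , continues , refl) r≤f)
      where
        l≤f : arity l ℕ.≤ f
        l≤f = ℕₚ.≤-pred (ℕₚ.≤-trans (ℕₚ.m<m+n (arity l) (arity-positive r)) n≤1+f)
        r≤f : arity r ℕ.≤ f
        r≤f = ℕₚ.≤-pred (ℕₚ.≤-trans (ℕₚ.m<n+m (arity r) (arity-positive l)) n≤1+f)

    leftFactors-complete : ∀ {f a n t} → LeftFactor a n t → n ℕ.≤ f → t ∈ leftFactors f a n
    leftFactors-complete {t = leaf} (_ , _ , refl) _ = here refl
    leftFactors-complete {f} {a} {t = node b l r} (nf , unrelated , refl) n≤f =
      ∈-++⁺ʳ (unit _) (∈-concat-tabulate⁺ _ b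
        (∈-if⁺ (incomparable? a b) unrelated (rooted-complete (nf , refl , refl) n≤f)))

    rightFactors-complete : ∀ {f a n t} → RightFactor a n t → n ℕ.≤ f → t ∈ rightFactors f a n
    rightFactors-complete (nf , inj₁ unrelated , arity≡n) n≤f =
      ∈-++⁺ˡ (leftFactors-complete (nf , unrelated , arity≡n) n≤f)
    rightFactors-complete {f} {a} {n} (nf , inj₂ root≡a , arity≡n) n≤f =
      ∈-++⁺ʳ (leftFactors f a n) (rooted-complete (nf , root≡a , arity≡n) n≤f)

  rooted-root : ∀ f f′ {a a′} n n′ {t} → t ∈ rooted f a n → t ∈ rooted f′ a′ n′ → a ≡ a′
  rooted-root f f′ _ _ t∈ t∈′ = Maybeₚ.just-injective
    (trans (sym (proj₁ (proj₂ (rooted-sound f t∈)))) (proj₁ (proj₂ (rooted-sound f′ t∈′))))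

  leaf∉rooted : ∀ f {a n} → ¬ leaf ∈ rooted f a n
  leaf∉rooted f leaf∈ with () ← proj₁ (proj₂ (rooted-sound f leaf∈))

  mutual
    rooted-unique : ∀ f a n → Unique (rooted f a n)
    rooted-unique zero    a n = []
    rooted-unique (suc f) a n = grafts-unique n (leftFactors-unique f a) (rightFactors-unique f a)
      λ l∈ l∈′ → trans (sym (proj₂ (proj₂ (leftFactors-sound f l∈)))) (proj₂ (proj₂ (leftFactors-sound f l∈′)))

    leftFactors-unique : ∀ f a n → Unique (leftFactors f a n)
    leftFactors-unique f a n = Uniqueₚ.++⁺ (unit-unique n)
      (concat-tabulate-unique _ (λ b → if-unique (incomparable? a b) (rooted-unique f b n))
        λ {b} {b′} t∈ t∈′ →
          rooted-root f f n n (proj₂ (∈-if⁻ (incomparable? a b) t∈)) (proj₂ (∈-if⁻ (incomparable? a b′) t∈′)))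
      λ (t∈unit , t∈rest) → leaf-excluded t∈unit t∈rest
      where
        leaf-excluded : ∀ {t} → t ∈ unit n →
                        ¬ t ∈ concat (tabulate λ b → if does (incomparable? a b) then rooted f b n else [])
        leaf-excluded t∈unit t∈rest with refl , _ ← ∈-unit⁻ t∈unit =
          let b , leaf∈b = ∈-concat-tabulate⁻ _ t∈rest in leaf∉rooted f (proj₂ (∈-if⁻ (incomparable? a b) leaf∈b))

    rightFactors-unique : ∀ f a n → Unique (rightFactors f a n)
    rightFactors-unique f a n = Uniqueₚ.++⁺ (leftFactors-unique f a n) (rooted-unique f a n)
      λ (t∈left , t∈right) → unrelated-to-itself (leftFactors-sound f t∈left) (rooted-sound f t∈right)
      where
        unrelated-to-itself : ∀ {t} → LeftFactor a n t → ¬ Rooted a n t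
        unrelated-to-itself {node a _ _} (_ , unrelated , _) (_ , refl , _) = unrelated comparable-refl

  rooted-enumerates : ∀ {f a n} → n ℕ.≤ f → Enumerates (Rooted a n) (rooted f a n)
  rooted-enumerates {f} {a} {n} n≤f = record
    { unique   = rooted-unique f a n
    ; sound    = rooted-sound f
    ; complete = λ rooted → rooted-complete rooted n≤f
    }

  normalForms-enumerates : ∀ n → Enumerates (NFOfArity n) (normalForms n)
  normalForms-enumerates n = record
    { unique   = Uniqueₚ.++⁺ (unit-unique n)
                   (concat-tabulate-unique rootedAt (λ a → rooted-unique (suc n) a n) (rooted-root (suc n) (suc n) n n))
                   λ (t∈unit , t∈rest) → leaf-excluded t∈unit t∈rest
    ; sound    = sound
    ; complete = complete
    }
    where
      rootedAt : Fin size → List (Tree Q)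
      rootedAt a = rooted (suc n) a n

      leaf-excluded : ∀ {t} → t ∈ unit n → ¬ t ∈ concat (tabulate rootedAt)
      leaf-excluded t∈unit t∈rest with refl , _ ← ∈-unit⁻ t∈unit =
        leaf∉rooted (suc n) {n = n} (proj₂ (∈-concat-tabulate⁻ rootedAt t∈rest))

      sound : ∀ {t} → t ∈ normalForms n → NFOfArity n t
      sound t∈ with ∈-++⁻ (unit n) t∈
      ... | inj₁ t∈unit with refl , refl ← ∈-unit⁻ t∈unit = tt , refl
      ... | inj₂ t∈rest =
        let nf , _ , arity≡n = rooted-sound (suc n) {n = n} (proj₂ (∈-concat-tabulate⁻ rootedAt t∈rest)) in nf , arity≡n

      complete : ∀ {t} → NFOfArity n t → t ∈ normalForms n
      complete {leaf}       (_  , refl) = here refl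
      complete {node a l r} (nf , refl) =
        ∈-++⁺ʳ (unit n) (∈-concat-tabulate⁺ rootedAt a (rooted-complete (nf , refl , refl) (ℕₚ.n≤1+n n)))

  normalForms-zero : normalForms 0 ≡ []
  normalForms-zero = enumeration-of-∅ (λ {t} (_ , arity≡0) → arity≢0 t arity≡0) (normalForms-enumerates 0)

  rootedSeries : Elt Q → Series
  rootedSeries a n = count (rooted (suc n) a n)

  count-rooted : ∀ {f a n} → n ℕ.≤ f → count (rooted f a n) ≡ rootedSeries a n
  count-rooted n≤f =
    cong fromℕℚ (enumerations-length (rooted-enumerates n≤f) (rooted-enumerates (ℕₚ.n≤1+n _)))

  rootedSeries-zero : ∀ a → rootedSeries a 0 ≡ 0ℚ
  rootedSeries-zero a = cong count
    (enumeration-of-∅ (λ {t} (_ , _ , arity≡0) → arity≢0 t arity≡0) (rooted-enumerates {1} {a} z≤n))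

  count-unit : ∀ n → count (unit n) ≡ tSeries n
  count-unit 0             = refl
  count-unit 1             = refl
  count-unit (suc (suc _)) = refl

  count-grafts : ∀ a F G n → count (grafts a F G n) ≡ convSum (count ∘ F) (count ∘ G) n
  count-grafts a F G zero    = count-cartesianProductWith (node a) (F 0) (G 0)
  count-grafts a F G (suc n) =
    trans (count-++ (cartesianProductWith (node a) (F 0) (G (suc n))) (grafts a (F ∘ suc) G n))
    (cong₂ ℚ._+_ (count-cartesianProductWith (node a) (F 0) (G (suc n))) (count-grafts a (F ∘ suc) G n))

  count-leftFactors : ∀ {f a n} → n ℕ.≤ f → count (leftFactors f a n) ≡ (tSeries ⊕ barSeries Q rootedSeries a) n
  count-leftFactors {f} {a} {n} n≤f = begin
    count (unit n ++ concat (tabulate rootedBelow))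
      ≡⟨ count-++ (unit n) (concat (tabulate rootedBelow)) ⟩
    count (unit n) ℚ.+ count (concat (tabulate rootedBelow))
      ≡⟨ cong₂ ℚ._+_ (count-unit n) (count-concat-tabulate rootedBelow) ⟩
    tSeries n ℚ.+ sumFin (count ∘ rootedBelow)
      ≡⟨ cong (tSeries n ℚ.+_) (sumFin-cong count-rootedBelow) ⟩
    tSeries n ℚ.+ sumFin (λ b → if does (incomparable? a b) then rootedSeries b n else 0ℚ)
      ≡⟨ cong (tSeries n ℚ.+_) (barSeries-select Q rootedSeries a n) ⟨
    tSeries n ℚ.+ barSeries Q rootedSeries a n
      ∎
    where
      open ≡-Reasoning
      rootedBelow : Fin size → List (Tree Q)
      rootedBelow b = if does (incomparable? a b) then rooted f b n else []

      count-rootedBelow : ∀ b → count (rootedBelow b) ≡ (if does (incomparable? a b) then rootedSeries b n else 0ℚ)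
      count-rootedBelow b = trans (count-if (incomparable? a b) (rooted f b n))
                                  (cong (λ q → if does (incomparable? a b) then q else 0ℚ) (count-rooted n≤f))

  count-rightFactors : ∀ {f a n} → n ℕ.≤ f →
    count (rightFactors f a n) ≡ ((tSeries ⊕ barSeries Q rootedSeries a) ⊕ rootedSeries a) n
  count-rightFactors {f} {a} {n} n≤f =
    trans (count-++ (leftFactors f a n) (rooted f a n)) (cong₂ ℚ._+_ (count-leftFactors n≤f) (count-rooted n≤f))

  rootedSeries-equation : ∀ a n → rootedSeries a n ≡
    ((tSeries ⊕ barSeries Q rootedSeries a) ⊗ ((tSeries ⊕ barSeries Q rootedSeries a) ⊕ rootedSeries a)) n
  rootedSeries-equation a n = trans (count-grafts a (leftFactors n a) (rightFactors n a) n)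
    (convSum-cong n λ i i≤n → cong₂ ℚ._*_ (count-leftFactors i≤n) (count-rightFactors (ℕₚ.m∸n≤m n i)))

  count-normalForms : ∀ n → count (normalForms n) ≡ (tSeries ⊕ sumSeries Q rootedSeries) n
  count-normalForms n = trans (count-++ (unit n) (concat (tabulate rootedAt)))
    (cong₂ ℚ._+_ (count-unit n) (count-concat-tabulate rootedAt))
    where
      rootedAt : Fin size → List (Tree Q)
      rootedAt a = rooted (suc n) a n

module Rewriting (Q : FinPoset) where
  open FinPoset Q hiding (Elt)
  open PosetProperties Q
  open NormalForms Q

  ≡⇒~ : ∀ {s t : Tree Q} → s ≡ t → s ~ t
  ≡⇒~ refl = ~-refl

  ~-setoid : Setoid 0ℓ 0ℓ
  ~-setoid = record
    { Carrier       = Tree Q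
    ; _≈_           = _~_
    ; isEquivalence = record { refl = ~-refl ; sym = ~-sym ; trans = ~-trans }
    }

  module ~-Reasoning = SetoidReasoning ~-setoid

  arity-resp-~ : ∀ {s t : Tree Q} → s ~ t → arity s ≡ arity t
  arity-resp-~ (rel₁ _ _ _ x y z _) = ℕₚ.+-assoc (arity x) (arity y) (arity z)
  arity-resp-~ (rel₂ _ _ _ x y z _) = ℕₚ.+-assoc (arity x) (arity y) (arity z)
  arity-resp-~ ~-refl               = refl
  arity-resp-~ (~-sym s~t)          = sym (arity-resp-~ s~t)
  arity-resp-~ (~-trans s~t t~u)    = trans (arity-resp-~ s~t) (arity-resp-~ t~u)
  arity-resp-~ (~-node _ l~l′ r~r′) = cong₂ ℕ._+_ (arity-resp-~ l~l′) (arity-resp-~ r~r′)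

  module _ {x y z : Tree Q} where

    assoc : ∀ L → node L (node L x y) z ~ node L x (node L y z)
    assoc L = rel₁ L L L x y z min-refl

    absorbˡ : ∀ {L c} → L ≤ c → node L (node c x y) z ~ node L (node L x y) z
    absorbˡ {L} {c} L≤c = ~-trans (rel₁ L c L x y z (inj₁ (L≤c , refl))) (~-sym (assoc L))

    absorbʳ : ∀ {L c} → L ≤ c → node L x (node c y z) ~ node L x (node L y z)
    absorbʳ {L} {c} L≤c = ~-trans (~-sym (rel₂ L c L x y z (inj₁ (L≤c , refl)))) (assoc L)

    lowerˡ : ∀ {L k} → L ≤ k → node k (node L x y) z ~ node L (node L x y) z
    lowerˡ {L} {k} L≤k = ~-trans (rel₁ k L L x y z (inj₂ (L≤k , refl))) (~-sym (assoc L))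

    lowerʳ : ∀ {L k} → L ≤ k → node k x (node L y z) ~ node L x (node L y z)
    lowerʳ {L} {k} L≤k = ~-trans (~-sym (rel₂ k L L x y z (inj₂ (L≤k , refl)))) (assoc L)

  relabel : ∀ {L k x y} → L ≤ k → L ≡ k ⊎ root x ≡ just L ⊎ root y ≡ just L → node k x y ~ node L x y
  relabel                  _   (inj₁ refl)        = ~-refl
  relabel {x = node _ _ _} L≤k (inj₂ (inj₁ refl)) = lowerˡ L≤k
  relabel {y = node _ _ _} L≤k (inj₂ (inj₂ refl)) = lowerʳ L≤k

module Labels (Q : FinPoset) where
  open FinPoset Q hiding (Elt)
  open PosetProperties Q

  record IsLeast (P : Pred (Elt Q) 0ℓ) (L : Elt Q) : Set where
    field
      member : P L
      least  : ∀ {x} → P x → L ≤ x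
  open IsLeast public

  isLeast-unique : ∀ {P L L′} → IsLeast P L → IsLeast P L′ → L ≡ L′
  isLeast-unique least-L least-L′ = antisym (least least-L (member least-L′)) (least least-L′ (member least-L))

  Root : Maybe (Elt Q) → Pred (Elt Q) 0ℓ
  Root m x = m ≡ just x

  Candidate : Elt Q → Pred (Elt Q) 0ℓ → Pred (Elt Q) 0ℓ
  Candidate k P x = x ≡ k ⊎ (P x × x ≤ k)

  -- The root label of the normal form of node k applied to normal forms whose roots lie in P.
  IsLabel : Elt Q → Pred (Elt Q) 0ℓ → Elt Q → Set
  IsLabel k P = IsLeast (Candidate k P)

  isLabel-≐ : ∀ {k P P′ L} → P ≐ P′ → IsLabel k P L → IsLabel k P′ L
  isLabel-≐ (P⊆P′ , P′⊆P) label = record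
    { member = Data.Sum.map₂ (Data.Product.map₁ P⊆P′) (member label)
    ; least  = least label ∘ Data.Sum.map₂ (Data.Product.map₁ P′⊆P)
    }

  isLabel-≤ : ∀ {k P L} → IsLabel k P L → L ≤ k
  isLabel-≤ label = least label (inj₁ refl)

  isLabel-comparable : ∀ {k P L x} → IsLabel k P L → P x → Comparable x L → L ≤ x
  isLabel-comparable label Px (inj₁ x≤L) = least label (inj₂ (Px , ≤-trans x≤L (isLabel-≤ label)))
  isLabel-comparable label Px (inj₂ L≤x) = L≤x

  isLabel-nest : ∀ {ko ki m P₁ P₂ L₁ L} → IsMin Q ko ki m →
    IsLabel ki P₁ L₁ → IsLabel ko (Root (just L₁) ∪ P₂) L → IsLabel m (P₁ ∪ P₂) L
  isLabel-nest {ki = ki} {m} {P₁} {P₂} {L₁} {L} (inj₁ (m≤ki , refl)) inner outer =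
    record { member = member′ (member outer) ; least = least′ }
    where
      member′ : Candidate m (Root (just L₁) ∪ P₂) L → Candidate m (P₁ ∪ P₂) L
      member′ (inj₁ L≡m)              = inj₁ L≡m
      member′ (inj₂ (inj₂ P₂L , L≤m)) = inj₂ (inj₂ P₂L , L≤m)
      member′ (inj₂ (inj₁ refl , L≤m)) with member inner
      ... | inj₁ refl      = inj₁ (antisym L≤m m≤ki)
      ... | inj₂ (P₁L , _) = inj₂ (inj₁ P₁L , L≤m)

      least′ : ∀ {x} → Candidate m (P₁ ∪ P₂) x → L ≤ x
      least′ (inj₁ refl)             = isLabel-≤ outer
      least′ (inj₂ (inj₂ P₂x , x≤m)) = least outer (inj₂ (inj₂ P₂x , x≤m))
      least′ (inj₂ (inj₁ P₁x , x≤m)) =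
        let L₁≤x = least inner (inj₂ (P₁x , ≤-trans x≤m m≤ki))
        in ≤-trans (least outer (inj₂ (inj₁ refl , ≤-trans L₁≤x x≤m))) L₁≤x
  isLabel-nest {ko} {_} {m} {P₁} {P₂} {L₁} {L} (inj₂ (m≤ko , refl)) inner outer =
    record { member = member′ (member outer) ; least = least′ }
    where
      L≤L₁ : L ≤ L₁
      L≤L₁ = least outer (inj₂ (inj₁ refl , ≤-trans (isLabel-≤ inner) m≤ko))

      L≤m : L ≤ m
      L≤m = ≤-trans L≤L₁ (isLabel-≤ inner)

      member′ : Candidate ko (Root (just L₁) ∪ P₂) L → Candidate m (P₁ ∪ P₂) L
      member′ (inj₁ refl)            = inj₁ (antisym L≤m m≤ko)
      member′ (inj₂ (inj₂ P₂L , _))  = inj₂ (inj₂ P₂L , L≤m)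
      member′ (inj₂ (inj₁ refl , _)) with member inner
      ... | inj₁ L≡m         = inj₁ L≡m
      ... | inj₂ (P₁L , L≤m) = inj₂ (inj₁ P₁L , L≤m)

      least′ : ∀ {x} → Candidate m (P₁ ∪ P₂) x → L ≤ x
      least′ (inj₁ refl)             = L≤m
      least′ (inj₂ (inj₂ P₂x , x≤m)) = least outer (inj₂ (inj₂ P₂x , ≤-trans x≤m m≤ko))
      least′ (inj₂ (inj₁ P₁x , x≤m)) = ≤-trans L≤L₁ (least inner (inj₂ (P₁x , x≤m)))

  _↓_ : Elt Q → Maybe (Elt Q) → Elt Q
  L ↓ nothing = L
  L ↓ just c with c ≤? L
  ... | yes _ = c
  ... | no _  = L

  label : Elt Q → Maybe (Elt Q) → Maybe (Elt Q) → Elt Q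
  label k c e = (k ↓ c) ↓ e

  module _ (forest : IsForest Q) where

    ↓-isLabel : ∀ {k P L} c → IsLabel k P L → IsLabel k (P ∪ Root c) (L ↓ c)
    ↓-isLabel nothing label = isLabel-≐ (inj₁ , Data.Sum.[ id , (λ ()) ]′) label
    ↓-isLabel {k} {P} {L} (just c) label with c ≤? L
    ... | yes c≤L = record { member = inj₂ (inj₂ refl , c≤k) ; least = least′ }
      where
        c≤k : c ≤ k
        c≤k = ≤-trans c≤L (isLabel-≤ label)

        least′ : ∀ {x} → Candidate k (P ∪ Root (just c)) x → c ≤ x
        least′ (inj₁ refl)             = c≤k
        least′ (inj₂ (inj₁ Px , x≤k))  = ≤-trans c≤L (least label (inj₂ (Px , x≤k)))
        least′ (inj₂ (inj₂ refl , _))  = ≤-refl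
    ... | no c≰L = record { member = Data.Sum.map₂ (Data.Product.map₁ inj₁) (member label) ; least = least′ }
      where
        least′ : ∀ {x} → Candidate k (P ∪ Root (just c)) x → L ≤ x
        least′ (inj₁ refl)               = isLabel-≤ label
        least′ (inj₂ (inj₁ Px , x≤k))    = least label (inj₂ (Px , x≤k))
        least′ (inj₂ (inj₂ refl , c≤k)) with forest-comparable forest c≤k (isLabel-≤ label)
        ... | inj₁ c≤L = ⊥-elim (c≰L c≤L)
        ... | inj₂ L≤c = L≤c

    label-isLabel : ∀ k c e → IsLabel k (Root c ∪ Root e) (label k c e)
    label-isLabel k c e = isLabel-≐ (Data.Sum.map₁ Data.Sum.[ (λ ()) , id ]′ , Data.Sum.map₁ inj₂)
      (↓-isLabel e (↓-isLabel c (record { member = inj₁ refl ; least = least′ })))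
      where
        least′ : ∀ {x} → Candidate k (λ _ → ⊥) x → k ≤ x
        least′ (inj₁ refl) = ≤-refl

    isLabel-≤-inner : ∀ {ko ki m P₁ P₂ L₁ L} → IsMin Q ko ki m →
      IsLabel ki P₁ L₁ → IsLabel ko (Root (just L₁) ∪ P₂) L → L ≤ L₁
    isLabel-≤-inner (inj₁ (ko≤ki , refl)) inner outer = isLabel-comparable outer (inj₁ refl)
      (forest-comparable forest (isLabel-≤ inner) (≤-trans (isLabel-≤ outer) ko≤ki))
    isLabel-≤-inner (inj₂ (ki≤ko , refl)) inner outer =
      least outer (inj₂ (inj₁ refl , ≤-trans (isLabel-≤ inner) ki≤ko))

module Factors (Q : FinPoset) where
  open FinPoset Q hiding (Elt)
  open PosetProperties Q
  open NormalForms Q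
  open Rewriting Q

  factors : Elt Q → Tree Q → List (Tree Q)
  factors L leaf = leaf ∷ []
  factors L (node c l r) with comparable? L c
  ... | yes _ = factors L l ++ factors L r
  ... | no _  = node c l r ∷ []

  -- comb L [] is a junk value: comb is only applied to nonempty lists.
  comb : Elt Q → List (Tree Q) → Tree Q
  comb L []           = leaf
  comb L (x ∷ [])     = x
  comb L (x ∷ y ∷ ys) = node L x (comb L (y ∷ ys))

  factors-nonEmpty : ∀ L t → NonEmpty (factors L t)
  factors-nonEmpty L leaf = tt
  factors-nonEmpty L (node c l r) with comparable? L c
  ... | yes _ = ++-nonEmptyˡ (factors L l) (factors-nonEmpty L l)
  ... | no _  = tt

  factors-comparable : ∀ {L c} l r → Comparable L c → factors L (node c l r) ≡ factors L l ++ factors L r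
  factors-comparable {L} {c} l r L~c with comparable? L c
  ... | yes _   = refl
  ... | no L≁c  = ⊥-elim (L≁c L~c)

  factors-unrelated : ∀ {L} t → Unrelated L (root t) → factors L t ≡ t ∷ []
  factors-unrelated         leaf         _    = refl
  factors-unrelated {L} (node c l r) L≁c with comparable? L c
  ... | yes L~c = ⊥-elim (L≁c L~c)
  ... | no _    = refl

  comb-∷ : ∀ {L x zs} → NonEmpty zs → comb L (x ∷ zs) ≡ node L x (comb L zs)
  comb-∷ {zs = _ ∷ _} _ = refl

  root-comb : ∀ L xs {ys} → NonEmpty xs → NonEmpty ys → root (comb L (xs ++ ys)) ≡ just L
  root-comb L (x ∷ xs) {ys} _ ne-ys with xs ++ ys | ++-nonEmptyʳ xs {ys} ne-ys
  ... | _ ∷ _ | _ = refl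

  comb-++ : ∀ L xs {ys} → NonEmpty xs → NonEmpty ys → node L (comb L xs) (comb L ys) ~ comb L (xs ++ ys)
  comb-++ L (x ∷ [])     ne-xs ne-ys = ≡⇒~ (sym (comb-∷ ne-ys))
  comb-++ L (x ∷ y ∷ xs) ne-xs ne-ys =
    ~-trans (assoc L) (~-node L ~-refl (comb-++ L (y ∷ xs) tt ne-ys))

  -- The nodes of t that factors L t dissolves all lie above L, so node L can absorb them.
  Absorbable : Elt Q → Tree Q → Set
  Absorbable L leaf         = ⊤
  Absorbable L (node c l r) = Comparable L c → L ≤ c × Absorbable L l × Absorbable L r

  IsNF⇒absorbable : ∀ {L} t → IsNF t → (∀ {c} → root t ≡ just c → Comparable c L → L ≤ c) → Absorbable L t
  IsNF⇒absorbable leaf _ _ = tt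
  IsNF⇒absorbable {L} (node c l r) (nf-l , nf-r , c≁l , continues) root-above L~c =
    L≤c , IsNF⇒absorbable l nf-l (unrelated-above c≁l) , IsNF⇒absorbable r nf-r (continues-above continues)
    where
      L≤c : L ≤ c
      L≤c = root-above refl (comparable-sym L~c)

      unrelated-above : ∀ {m} → Unrelated c m → ∀ {d} → m ≡ just d → Comparable d L → L ≤ d
      unrelated-above c≁d refl (inj₁ d≤L) = ⊥-elim (c≁d (inj₂ (≤-trans d≤L L≤c)))
      unrelated-above _   refl (inj₂ L≤d) = L≤d

      continues-above : ∀ {m} → Continues c m → ∀ {d} → m ≡ just d → Comparable d L → L ≤ d
      continues-above (inj₁ c≁m) = unrelated-above c≁m
      continues-above (inj₂ refl) refl _ = L≤c

  node~factorsˡ : ∀ {L} t {ys} → Absorbable L t → NonEmpty ys → node L t (comb L ys) ~ comb L (factors L t ++ ys)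
  node~factorsˡ leaf {_ ∷ _} _ _ = ~-refl
  node~factorsˡ {L} (node c l r) {ys} absorbable ne with comparable? L c
  ... | no _    = ≡⇒~ (sym (comb-∷ ne))
  ... | yes L~c =
    let L≤c , absorbable-l , absorbable-r = absorbable L~c in begin
    node L (node c l r) (comb L ys)              ≈⟨ absorbˡ L≤c ⟩
    node L (node L l r) (comb L ys)              ≈⟨ assoc L ⟩
    node L l (node L r (comb L ys))              ≈⟨ ~-node L ~-refl (node~factorsˡ r absorbable-r ne) ⟩
    node L l (comb L (factors L r ++ ys))        ≈⟨ node~factorsˡ l absorbable-l (++-nonEmptyʳ (factors L r) ne) ⟩
    comb L (factors L l ++ factors L r ++ ys)    ≡⟨ cong (comb L) (Listₚ.++-assoc (factors L l) (factors L r) ys) ⟨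
    comb L ((factors L l ++ factors L r) ++ ys)  ∎
    where open ~-Reasoning

  node~factorsʳ : ∀ {L} ys t → NonEmpty ys → Absorbable L t → node L (comb L ys) t ~ comb L (ys ++ factors L t)
  node~factorsʳ {L} ys leaf ne _ = comb-++ L ys ne tt
  node~factorsʳ {L} ys (node c l r) ne absorbable with comparable? L c
  ... | no _    = comb-++ L ys ne tt
  ... | yes L~c =
    let L≤c , absorbable-l , absorbable-r = absorbable L~c in begin
    node L (comb L ys) (node c l r)              ≈⟨ absorbʳ L≤c ⟩
    node L (comb L ys) (node L l r)              ≈⟨ assoc L ⟨
    node L (node L (comb L ys) l) r              ≈⟨ ~-node L (node~factorsʳ ys l ne absorbable-l) ~-refl ⟩
    node L (comb L (ys ++ factors L l)) r
      ≈⟨ node~factorsʳ (ys ++ factors L l) r (++-nonEmptyʳ ys (factors-nonEmpty L l)) absorbable-r ⟩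
    comb L ((ys ++ factors L l) ++ factors L r)  ≡⟨ cong (comb L) (Listₚ.++-assoc ys (factors L l) (factors L r)) ⟩
    comb L (ys ++ factors L l ++ factors L r)    ∎
    where open ~-Reasoning

  regroup : Elt Q → Tree Q → Tree Q → Tree Q
  regroup L x y = comb L (factors L x ++ factors L y)

  node~regroup : ∀ {L} x y → Absorbable L x → Absorbable L y → node L x y ~ regroup L x y
  node~regroup {L} x y absorbable-x absorbable-y = begin
    node L x y                             ≈⟨ node~factorsʳ (x ∷ []) y tt absorbable-y ⟩
    comb L (x ∷ factors L y)               ≡⟨ comb-∷ (factors-nonEmpty L y) ⟩
    node L x (comb L (factors L y))        ≈⟨ node~factorsˡ x absorbable-x (factors-nonEmpty L y) ⟩
    comb L (factors L x ++ factors L y)    ∎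
    where open ~-Reasoning

  Factor : Elt Q → Tree Q → Set
  Factor L s = IsNF s × Unrelated L (root s)

  factors-IsNF : ∀ L t → IsNF t → All (Factor L) (factors L t)
  factors-IsNF L leaf         _                      = (tt , tt) ∷ []
  factors-IsNF L (node c l r) nf@(nf-l , nf-r , _) with comparable? L c
  ... | yes _  = Allₚ.++⁺ (factors-IsNF L l nf-l) (factors-IsNF L r nf-r)
  ... | no L≁c = (nf , L≁c) ∷ []

  comb-IsNF : ∀ L xs → All (Factor L) xs → NonEmpty xs → IsNF (comb L xs)
  comb-IsNF L (x ∷ [])         ((nf , _) ∷ [])                          _ = nf
  comb-IsNF L (x ∷ y ∷ [])     ((nf-x , L≁x) ∷ (nf-y , L≁y) ∷ [])       _ = nf-x , nf-y , L≁x , inj₁ L≁y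
  comb-IsNF L (x ∷ y ∷ z ∷ zs) ((nf-x , L≁x) ∷ factors-y∷z∷zs)          _ =
    nf-x , comb-IsNF L (y ∷ z ∷ zs) factors-y∷z∷zs tt , L≁x , inj₂ refl

  comb-factors : ∀ a r → IsNF r → Continues a (root r) → comb a (factors a r) ≡ r
  comb-factors a r _ (inj₁ a≁r) = cong (comb a) (factors-unrelated r a≁r)
  comb-factors a (node .a l r) (_ , nf-r , a≁l , continues) (inj₂ refl) = begin
    comb a (factors a (node a l r))          ≡⟨ cong (comb a) (factors-comparable l r comparable-refl) ⟩
    comb a (factors a l ++ factors a r)      ≡⟨ cong (λ ls → comb a (ls ++ factors a r)) (factors-unrelated l a≁l) ⟩
    comb a (l ∷ factors a r)                 ≡⟨ comb-∷ (factors-nonEmpty a r) ⟩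
    node a l (comb a (factors a r))          ≡⟨ cong (node a l) (comb-factors a r nf-r continues) ⟩
    node a l r                               ∎
    where open ≡-Reasoning

  factors-comb : ∀ {L L₁} → Comparable L L₁ → ∀ xs → NonEmpty xs →
                 factors L (comb L₁ xs) ≡ List.concatMap (factors L) xs
  factors-comb {L} _    (x ∷ [])     _ = sym (Listₚ.++-identityʳ (factors L x))
  factors-comb {L} {L₁} L~L₁ (x ∷ y ∷ ys) _ =
    trans (factors-comparable x (comb L₁ (y ∷ ys)) L~L₁) (cong (factors L x ++_) (factors-comb L~L₁ (y ∷ ys) tt))

module Normalisation (Q : FinPoset) (forest : IsForest Q) where
  open FinPoset Q hiding (Elt)
  open PosetProperties Q
  open NormalForms Q
  open Rewriting Q
  open Labels Q
  open Factors Q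

  concatMap-factors : ∀ {L L₁} → L ≤ L₁ → ∀ t → List.concatMap (factors L) (factors L₁ t) ≡ factors L t
  concatMap-factors L≤L₁ leaf = refl
  concatMap-factors {L} {L₁} L≤L₁ (node c l r) with comparable? L₁ c
  ... | no _     = Listₚ.++-identityʳ (factors L (node c l r))
  ... | yes L₁~c = begin
    List.concatMap (factors L) (factors L₁ l ++ factors L₁ r)
      ≡⟨ Listₚ.concatMap-++ (factors L) (factors L₁ l) (factors L₁ r) ⟩
    List.concatMap (factors L) (factors L₁ l) ++ List.concatMap (factors L) (factors L₁ r)
      ≡⟨ cong₂ _++_ (concatMap-factors L≤L₁ l) (concatMap-factors L≤L₁ r) ⟩
    factors L l ++ factors L r
      ≡⟨ factors-comparable l r (comparable-below forest L≤L₁ L₁~c) ⟨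
    factors L (node c l r)
      ∎
    where open ≡-Reasoning

  star : Elt Q → Tree Q → Tree Q → Tree Q
  star k x y = regroup (label k (root x) (root y)) x y

  root-star : ∀ k x y → root (star k x y) ≡ just (label k (root x) (root y))
  root-star k x y = root-comb L (factors L x) (factors-nonEmpty L x) (factors-nonEmpty L y)
    where
      L : Elt Q
      L = label k (root x) (root y)

  factors-regroup : ∀ {L L₀} x y → L ≤ L₀ → factors L (regroup L₀ x y) ≡ factors L x ++ factors L y
  factors-regroup {L} {L₀} x y L≤L₀ = begin
    factors L (comb L₀ (factors L₀ x ++ factors L₀ y))
      ≡⟨ factors-comb (inj₁ L≤L₀) (factors L₀ x ++ factors L₀ y) (++-nonEmptyʳ (factors L₀ x) (factors-nonEmpty L₀ y)) ⟩
    List.concatMap (factors L) (factors L₀ x ++ factors L₀ y)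
      ≡⟨ Listₚ.concatMap-++ (factors L) (factors L₀ x) (factors L₀ y) ⟩
    List.concatMap (factors L) (factors L₀ x) ++ List.concatMap (factors L) (factors L₀ y)
      ≡⟨ cong₂ _++_ (concatMap-factors L≤L₀ x) (concatMap-factors L≤L₀ y) ⟩
    factors L x ++ factors L y
      ∎
    where open ≡-Reasoning

  label₃ : Elt Q → (c e f : Maybe (Elt Q)) → Elt Q
  label₃ m c e f = label m c e ↓ f

  label₃-isLabel : ∀ m c e f → IsLabel m ((Root c ∪ Root e) ∪ Root f) (label₃ m c e f)
  label₃-isLabel m c e f = ↓-isLabel forest f (label-isLabel forest m c e)

  regroup₃ : Elt Q → Tree Q → Tree Q → Tree Q → Tree Q
  regroup₃ L x y z = comb L (factors L x ++ factors L y ++ factors L z)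

  star-nestˡ : ∀ {a b m} → IsMin Q a b m → ∀ x y z →
    star a (star b x y) z ≡ regroup₃ (label₃ m (root x) (root y) (root z)) x y z
  star-nestˡ {a} {b} {m} a↑b x y z = begin
    star a (star b x y) z
      ≡⟨ cong (λ L′ → regroup L′ (star b x y) z) outer-label ⟩
    regroup L (star b x y) z
      ≡⟨ cong (λ xys → comb L (xys ++ factors L z)) (factors-regroup x y L≤Lb) ⟩
    comb L ((factors L x ++ factors L y) ++ factors L z)
      ≡⟨ cong (comb L) (Listₚ.++-assoc (factors L x) (factors L y) (factors L z)) ⟩
    regroup₃ L x y z
      ∎
    where
      open ≡-Reasoning
      Lb L : Elt Q
      Lb = label b (root x) (root y)
      L  = label₃ m (root x) (root y) (root z)

      inner : IsLabel b (Root (root x) ∪ Root (root y)) Lb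
      inner = label-isLabel forest b (root x) (root y)

      outer : IsLabel a (Root (just Lb) ∪ Root (root z)) (label a (just Lb) (root z))
      outer = label-isLabel forest a (just Lb) (root z)

      outer-label : label a (root (star b x y)) (root z) ≡ L
      outer-label = trans (cong (λ ρ → label a ρ (root z)) (root-star b x y))
        (isLeast-unique (isLabel-nest a↑b inner outer) (label₃-isLabel m (root x) (root y) (root z)))

      L≤Lb : L ≤ Lb
      L≤Lb = subst (_≤ Lb) outer-label (subst (λ ρ → label a ρ (root z) ≤ Lb) (sym (root-star b x y))
        (isLabel-≤-inner forest a↑b inner outer))

  star-nestʳ : ∀ {a b m} → IsMin Q a b m → ∀ x y z →
    star a x (star b y z) ≡ regroup₃ (label₃ m (root x) (root y) (root z)) x y z
  star-nestʳ {a} {b} {m} a↑b x y z = begin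
    star a x (star b y z)
      ≡⟨ cong (λ L′ → regroup L′ x (star b y z)) outer-label ⟩
    regroup L x (star b y z)
      ≡⟨ cong (λ yzs → comb L (factors L x ++ yzs)) (factors-regroup y z L≤Lb) ⟩
    regroup₃ L x y z
      ∎
    where
      open ≡-Reasoning
      Lb L : Elt Q
      Lb = label b (root y) (root z)
      L  = label₃ m (root x) (root y) (root z)

      inner : IsLabel b (Root (root y) ∪ Root (root z)) Lb
      inner = label-isLabel forest b (root y) (root z)

      outer : IsLabel a (Root (just Lb) ∪ Root (root x)) (label a (root x) (just Lb))
      outer = isLabel-≐ (Data.Sum.swap , Data.Sum.swap) (label-isLabel forest a (root x) (just Lb))

      rotate : (Root (root y) ∪ Root (root z)) ∪ Root (root x) ≐ (Root (root x) ∪ Root (root y)) ∪ Root (root z)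
      rotate = Data.Sum.assocˡ ∘ Data.Sum.swap , Data.Sum.swap ∘ Data.Sum.assocʳ

      outer-label : label a (root x) (root (star b y z)) ≡ L
      outer-label = trans (cong (label a (root x)) (root-star b y z))
        (isLeast-unique (isLabel-≐ rotate (isLabel-nest a↑b inner outer)) (label₃-isLabel m (root x) (root y) (root z)))

      L≤Lb : L ≤ Lb
      L≤Lb = subst (_≤ Lb) outer-label (subst (λ ρ → label a (root x) ρ ≤ Lb) (sym (root-star b y z))
        (isLabel-≤-inner forest a↑b inner outer))

  star-rel₁ : ∀ {a b m} → IsMin Q a b m → ∀ x y z → star a (star b x y) z ≡ star m x (star m y z)
  star-rel₁ a↑b x y z = trans (star-nestˡ a↑b x y z) (sym (star-nestʳ min-refl x y z))

  star-rel₂ : ∀ {a b m} → IsMin Q a b m → ∀ x y z → star m (star m x y) z ≡ star a x (star b y z)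
  star-rel₂ a↑b x y z = trans (star-nestˡ min-refl x y z) (sym (star-nestʳ a↑b x y z))

  star-IsNF : ∀ k {x y} → IsNF x → IsNF y → IsNF (star k x y)
  star-IsNF k {x} {y} nf-x nf-y = comb-IsNF L (factors L x ++ factors L y)
    (Allₚ.++⁺ (factors-IsNF L x nf-x) (factors-IsNF L y nf-y)) (++-nonEmptyʳ (factors L x) (factors-nonEmpty L y))
    where
      L : Elt Q
      L = label k (root x) (root y)

  node~star : ∀ k {x y} → IsNF x → IsNF y → node k x y ~ star k x y
  node~star k {x} {y} nf-x nf-y =
    ~-trans (relabel (isLabel-≤ isLabel) (Data.Sum.map₂ proj₁ (member isLabel)))
            (node~regroup x y (IsNF⇒absorbable x nf-x (isLabel-comparable isLabel ∘ inj₁))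
                              (IsNF⇒absorbable y nf-y (isLabel-comparable isLabel ∘ inj₂)))
    where
      isLabel : IsLabel k (Root (root x) ∪ Root (root y)) (label k (root x) (root y))
      isLabel = label-isLabel forest k (root x) (root y)

  normalise : Tree Q → Tree Q
  normalise leaf         = leaf
  normalise (node a l r) = star a (normalise l) (normalise r)

  normalise-IsNF : ∀ t → IsNF (normalise t)
  normalise-IsNF leaf         = tt
  normalise-IsNF (node a l r) = star-IsNF a (normalise-IsNF l) (normalise-IsNF r)

  normalise-~ : ∀ t → t ~ normalise t
  normalise-~ leaf         = ~-refl
  normalise-~ (node a l r) =
    ~-trans (~-node a (normalise-~ l) (normalise-~ r)) (node~star a (normalise-IsNF l) (normalise-IsNF r))

  normalise-resp-~ : ∀ {s t} → s ~ t → normalise s ≡ normalise t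
  normalise-resp-~ (rel₁ a b m x y z a↑b) = star-rel₁ a↑b (normalise x) (normalise y) (normalise z)
  normalise-resp-~ (rel₂ a b m x y z a↑b) = star-rel₂ a↑b (normalise x) (normalise y) (normalise z)
  normalise-resp-~ ~-refl                 = refl
  normalise-resp-~ (~-sym t~s)            = sym (normalise-resp-~ t~s)
  normalise-resp-~ (~-trans s~t t~u)      = trans (normalise-resp-~ s~t) (normalise-resp-~ t~u)
  normalise-resp-~ (~-node a l~l′ r~r′)   = cong₂ (star a) (normalise-resp-~ l~l′) (normalise-resp-~ r~r′)

  label-IsNF : ∀ a l r → IsNF (node a l r) → label a (root l) (root r) ≡ a
  label-IsNF a l r (_ , _ , a≁l , continues) =
    isLeast-unique (label-isLabel forest a (root l) (root r)) (record { member = inj₁ refl ; least = least′ })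
    where
      continues-least : ∀ {m x} → Continues a m → m ≡ just x → x ≤ a → a ≤ x
      continues-least (inj₁ a≁m)  refl x≤a = ⊥-elim (a≁m (inj₂ x≤a))
      continues-least (inj₂ refl) refl _   = ≤-refl

      least′ : ∀ {x} → Candidate a (Root (root l) ∪ Root (root r)) x → a ≤ x
      least′ (inj₁ refl)                  = ≤-refl
      least′ (inj₂ (inj₁ root-l≡x , x≤a)) = continues-least (inj₁ a≁l) root-l≡x x≤a
      least′ (inj₂ (inj₂ root-r≡x , x≤a)) = continues-least continues root-r≡x x≤a

  normalise-id : ∀ {t} → IsNF t → normalise t ≡ t
  normalise-id {leaf}       _  = refl
  normalise-id {node a l r} nf@(nf-l , nf-r , a≁l , continues) = begin
    star a (normalise l) (normalise r)   ≡⟨ cong₂ (star a) (normalise-id nf-l) (normalise-id nf-r) ⟩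
    star a l r                           ≡⟨ cong (λ L → regroup L l r) (label-IsNF a l r nf) ⟩
    comb a (factors a l ++ factors a r)  ≡⟨ cong (λ ls → comb a (ls ++ factors a r)) (factors-unrelated l a≁l) ⟩
    comb a (l ∷ factors a r)             ≡⟨ comb-∷ (factors-nonEmpty a r) ⟩
    node a l (comb a (factors a r))      ≡⟨ cong (node a l) (comb-factors a r nf-r continues) ⟩
    node a l r                           ∎
    where open ≡-Reasoning

dimAs-normalForms : ∀ {Q} → IsForest Q → ∀ {n d} → DimAs Q n d → d ≡ length (Counting.normalForms Q n)
dimAs-normalForms {Q} forest {n} {d} (rep , arity-rep , rep-injective , rep-surjective) = begin
  d                                    ≡⟨ Listₚ.length-tabulate (normalise ∘ rep) ⟨
  length (tabulate (normalise ∘ rep))  ≡⟨ enumerations-length normalised-reps (normalForms-enumerates n) ⟩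
  length (normalForms n)               ∎
  where
    open ≡-Reasoning
    open NormalForms Q
    open Rewriting Q
    open Counting Q
    open Normalisation Q forest

    normalised-reps : Enumerates (NFOfArity n) (tabulate (normalise ∘ rep))
    normalised-reps = record
      { unique   = Uniqueₚ.tabulate⁺ λ {i} {j} eq →
          rep-injective i j (~-trans (normalise-~ (rep i)) (~-trans (≡⇒~ eq) (~-sym (normalise-~ (rep j)))))
      ; sound    = λ t∈ → let i , t≡ = ∈-tabulate⁻ t∈ in
          subst (NFOfArity n) (sym t≡)
            (normalise-IsNF (rep i) , trans (sym (arity-resp-~ (normalise-~ (rep i)))) (arity-rep i))
      ; complete = λ {t} (nf , arity≡n) → let i , t~rep = rep-surjective t arity≡n in
          subst (_∈ tabulate (normalise ∘ rep)) (trans (sym (normalise-resp-~ t~rep)) (normalise-id nf)) (∈-tabulate⁺ i)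
      }

proposition3p6 : (Q : FinPoset) → IsForest Q →
    (d : ℕ → ℕ) → (∀ n → DimAs Q (suc n) (d (suc n))) →
    Σ (Elt Q → Series) λ H →
      (∀ a → H a 0 ≡ 0ℚ) ×
      (∀ n → hilbert d n ≡ (tSeries ⊕ sumSeries Q H) n) ×
      (∀ a n → H a n ≡ ((tSeries ⊕ barSeries Q H a) ⊗ ((tSeries ⊕ barSeries Q H a) ⊕ H a)) n)
proposition3p6 Q forest d dim = rootedSeries , rootedSeries-zero , hilbert-count , rootedSeries-equation
  where
    open Counting Q

    hilbert-count : ∀ n → hilbert d n ≡ (tSeries ⊕ sumSeries Q rootedSeries) n
    hilbert-count zero    = trans (cong count (sym normalForms-zero)) (count-normalForms 0)
    hilbert-count (suc n) = trans (cong fromℕℚ (dimAs-normalForms forest (dim n))) (count-normalForms (suc n))
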